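{- Let $G$ be a finite vertex-transitive graph in which every vertex has a nonadjacent twin, and let $\widetilde G$ be its nonadjacent twin quotient graph. Then $G$ is arc-transitive if and only if $\widetilde G$ is arc-transitive.
   Context: Distinct vertices $u,v$ are nonadjacent twins if $N(u)=N(v)$, where $N(u)$ is the open neighborhood. The nonadjacent twin quotient graph $\widetilde G$ has as vertices the equivalence classes of the relation $N(u)=N(v)$, with distinct classes adjacent iff some representatives are adjacent in $G$. A graph is arc-transitive if its automorphism group acts transitively on ordered pairs of adjacent vertices. -}

module Defs where

open import Level using (Level; 0ℓ)
open import Data.Bool using (Bool; true; false; T)
open import Data.Bool.Properties using () renaming (_≟_ to _≟ᵇ_)
open import Data.Nat using (ℕ)
open import Data.Fin using (Fin; _≤_)
open import Data.Fin.Properties using (all?; _≤?_)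
open import Data.Product using (Σ; ∃; ∃-syntax; _×_; _,_; proj₁)
open import Relation.Nullary using (¬_; Dec)
open import Relation.Nullary.Decidable using (⌊_⌋; _→-dec_)
open import Relation.Binary.PropositionalEquality using (_≡_)
open import Function.Bundles using (_↔_; Inverse; _⇔_)

record Graph : Set₁ where
  field
    V   : Set
    Adj : V → V → Set
    Adj-sym : ∀ {u v} → Adj u v → Adj v u
    Adj-irr : ∀ {u} → ¬ Adj u u
open Graph public

record Automorphism (G : Graph) : Set where
  field
    perm     : V G ↔ V G
    preserve : ∀ u v → Adj G u v ⇔ Adj G (Inverse.to perm u) (Inverse.to perm v)
open Automorphism public

app : {G : Graph} → Automorphism G → V G → V G
app σ = Inverse.to (perm σ)

VertexTransitive : Graph → Set
VertexTransitive G = ∀ u v → Σ (Automorphism G) λ σ → app σ u ≡ v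

ArcTransitive : Graph → Set
ArcTransitive G = ∀ u v x y → Adj G u v → Adj G x y →
  Σ (Automorphism G) λ σ → (app σ u ≡ x × app σ v ≡ y)

record FinGraph (n : ℕ) : Set where
  field
    adj    : Fin n → Fin n → Bool
    adjSym : ∀ u v → adj u v ≡ adj v u
    adjIrr : ∀ u → adj u u ≡ false
open FinGraph public

module _ {n : ℕ} (G : FinGraph n) where

  Adjᶠ : Fin n → Fin n → Set
  Adjᶠ u v = adj G u v ≡ true

  SameNbhd : Fin n → Fin n → Set
  SameNbhd u v = ∀ w → adj G u w ≡ adj G v w

  sameNbhd? : ∀ u v → Dec (SameNbhd u v)
  sameNbhd? u v = all? (λ w → adj G u w ≟ᵇ adj G v w)

  HasNonadjTwin : Fin n → Set
  HasNonadjTwin u = Σ (Fin n) λ v → ¬ (u ≡ v) × SameNbhd u v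

  -- u is the least element of its class under N(u) = N(v)
  -- (used to pick one canonical representative per equivalence class).
  IsRep : Fin n → Set
  IsRep u = ∀ w → SameNbhd w u → u ≤ w

  isRep? : ∀ u → Dec (IsRep u)
  isRep? u = all? (λ w → sameNbhd? w u →-dec u ≤? w)

open import Relation.Binary.PropositionalEquality using (sym; trans; cong)
open import Data.Bool.Properties using (not-¬)

toGraph : {n : ℕ} → FinGraph n → Graph
toGraph {n} G = record
  { V = Fin n
  ; Adj = Adjᶠ G
  ; Adj-sym = λ {u} {v} e → trans (adjSym G v u) e
  ; Adj-irr = λ {u} e → not-¬ (adjIrr G u) e
  }

-- Its vertices are the equivalence
-- classes of N(u) = N(v), each represented by its least member; two distinct
-- classes are adjacent iff some representatives are adjacent in G.

module _ {n : ℕ} (G : FinGraph n) where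

  QVertex : Set
  QVertex = Σ (Fin n) λ u → T ⌊ isRep? G u ⌋

  QAdj : QVertex → QVertex → Set
  QAdj p q = ¬ (proj₁ p ≡ proj₁ q) ×
    Σ (Fin n) λ a → Σ (Fin n) λ b →
      SameNbhd G a (proj₁ p) × SameNbhd G b (proj₁ q) × Adjᶠ G a b

  private
    qsym : ∀ {p q} → QAdj p q → QAdj q p
    qsym (ne , a , b , sa , sb , e) =
      (λ eq → ne (sym eq)) , b , a , sb , sa , trans (adjSym G b a) e

  twinQuotient : Graph
  twinQuotient = record
    { V = QVertex
    ; Adj = QAdj
    ; Adj-sym = λ {p} {q} → qsym {p} {q}
    ; Adj-irr = λ { (ne , _) → ne _≡_.refl }
    }

{-# OPTIONS --safe #-}
-- Adjacency in G depends only on twin classes, and every automorphism of G permutes the twin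
-- classes, so it induces an automorphism of the quotient; hence G arc-transitive implies the
-- quotient arc-transitive. Conversely, let τ be an automorphism of the quotient carrying the
-- classes of an arc (u, v) to those of an arc (x, y); adjacent vertices are never twins, so
-- [u] ≠ [v]. Vertex-transitivity yields, for every class r, an automorphism g r of G sending
-- some vertex of r into τ r, chosen to send u to x and v to y. As g r preserves twin classes it
-- maps r into τ r, so the maps g r, each applied on its own class r, glue to a bijection of G
-- lying over τ, which preserves adjacency because adjacency only sees classes.
module Submission where

open import Defs
open import Data.Nat using (ℕ; z≤n; s≤s)
open import Data.Bool using (Bool; true)
open import Data.Bool.Properties using (T-irrelevant; ⇔→≡)
open import Data.Fin using (Fin; zero; suc; _≤_)
open import Data.Fin.Properties using (≤-antisym) renaming (_≟_ to _≟ᶠ_)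
open import Data.Product using (∃; _×_; _,_; proj₁; proj₂)
open import Data.Product.Properties using (Σ-≡,≡→≡)
open import Function.Bundles using (_↔_; _⇔_; mk⇔; Equivalence; Inverse; mk↔ₛ′)
open import Function.Properties.Inverse using (↔-sym)
import Function.Properties.Equivalence as ⇔
open import Relation.Nullary using (¬_; yes; no; contradiction)
open import Relation.Nullary.Decidable using (toWitness; fromWitness; map′)
open import Relation.Unary using (Pred; Decidable)
open import Relation.Binary using (DecidableEquality)
open import Relation.Binary.PropositionalEquality
  using (_≡_; _≢_; refl; sym; trans; cong; cong₂; subst; subst₂; module ≡-Reasoning)

∃⟶∃-least : ∀ {n p} (P : Pred (Fin n) p) → Decidable P →
            ∃ P → ∃ λ i → P i × (∀ j → P j → i ≤ j)
∃⟶∃-least P P? (zero , P0) = zero , P0 , λ _ _ → z≤n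
∃⟶∃-least P P? (suc i , Pi) with P? zero
... | yes P0 = zero , P0 , λ _ _ → z≤n
... | no ¬P0 with k , Pk , least ← ∃⟶∃-least (λ j → P (suc j)) (λ j → P? (suc j)) (i , Pi)
  = suc k , Pk , least′
  where
  least′ : ∀ j → P j → suc k ≤ j
  least′ zero    P0 = contradiction P0 ¬P0
  least′ (suc j) Pj = s≤s (least j Pj)

invert : {H : Graph} → Automorphism H → Automorphism H
invert {H} σ = record
  { perm     = ↔-sym (perm σ)
  ; preserve = λ u v → ⇔.sym (subst₂ (λ a b → Adj H (from u) (from v) ⇔ Adj H a b)
                                     (strictlyInverseˡ u) (strictlyInverseˡ v)
                                     (preserve σ (from u) (from v)))
  }
  where open Inverse (perm σ)

module BooleanAdjacency (H : Graph) (χ : V H → V H → Bool)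
                        (Adj⇔χ : ∀ u v → Adj H u v ⇔ χ u v ≡ true) where

  χ-app : (σ : Automorphism H) → ∀ u v → χ (app σ u) (app σ v) ≡ χ u v
  χ-app σ u v = ⇔→≡ (⇔.trans (⇔.sym (Adj⇔χ _ _))
                    (⇔.trans (⇔.sym (preserve σ u v)) (Adj⇔χ u v)))

  χ-automorphism : (f : V H ↔ V H) →
                   (∀ u v → χ (Inverse.to f u) (Inverse.to f v) ≡ χ u v) → Automorphism H
  χ-automorphism f χ-f = record
    { perm     = f
    ; preserve = λ u v → ⇔.trans (Adj⇔χ u v)
                           (⇔.trans (subst (λ b → (χ u v ≡ true) ⇔ (b ≡ true))
                                           (sym (χ-f u v)) ⇔.refl)
                                    (⇔.sym (Adj⇔χ _ _)))
    }

module TwinClasses {n : ℕ} (G : FinGraph n) where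

  infix 4 _≈_
  _≈_ : Fin n → Fin n → Set
  _≈_ = SameNbhd G

  ≈-refl : ∀ {a} → a ≈ a
  ≈-refl w = refl

  ≈-sym : ∀ {a b} → a ≈ b → b ≈ a
  ≈-sym a≈b w = sym (a≈b w)

  ≈-trans : ∀ {a b c} → a ≈ b → b ≈ c → a ≈ c
  ≈-trans a≈b b≈c w = trans (a≈b w) (b≈c w)

  adj-resp-≈ : ∀ {a a′ b b′} → a ≈ a′ → b ≈ b′ → adj G a b ≡ adj G a′ b′
  adj-resp-≈ {a} {a′} {b} {b′} a≈a′ b≈b′ = begin
    adj G a  b  ≡⟨ a≈a′ b ⟩
    adj G a′ b  ≡⟨ adjSym G a′ b ⟩
    adj G b  a′ ≡⟨ b≈b′ a′ ⟩
    adj G b′ a′ ≡⟨ adjSym G b′ a′ ⟩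
    adj G a′ b′ ∎
    where open ≡-Reasoning

  Adjᶠ⇒≉ : ∀ {a b} → Adjᶠ G a b → ¬ a ≈ b
  Adjᶠ⇒≉ {a} {b} a~b a≈b with () ← trans (sym a~b) (trans (a≈b b) (adjIrr G b))

  rep : QVertex G → Fin n
  rep = proj₁

  ≈⇒≡ : ∀ (p q : QVertex G) → rep p ≈ rep q → p ≡ q
  ≈⇒≡ (a , a-least) (b , b-least) a≈b = Σ-≡,≡→≡ (a≡b , T-irrelevant _ _)
    where
    a≡b : a ≡ b
    a≡b = ≤-antisym (toWitness a-least b (≈-sym a≈b)) (toWitness b-least a a≈b)

  -- Only the specification rep-[] of the least representative is ever used; opacity keeps
  -- with-abstractions over goals mentioning [_] from unfolding the search.
  opaque
    [_] : Fin n → QVertex G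
    [ w ] with u , u≈w , least ← ∃⟶∃-least (_≈ w) (λ u → sameNbhd? G u w) (w , ≈-refl)
      = u , fromWitness λ v v≈u → least v (≈-trans v≈u u≈w)

    rep-[] : ∀ w → rep [ w ] ≈ w
    rep-[] w with u , u≈w , _ ← ∃⟶∃-least (_≈ w) (λ u → sameNbhd? G u w) (w , ≈-refl)
      = u≈w

  []-≈ : ∀ {a b} → a ≈ b → [ a ] ≡ [ b ]
  []-≈ {a} {b} a≈b = ≈⇒≡ [ a ] [ b ] (≈-trans (rep-[] a) (≈-trans a≈b (≈-sym (rep-[] b))))

  []-≡ : ∀ {a b} → [ a ] ≡ [ b ] → a ≈ b
  []-≡ {a} {b} [a]≡[b] =
    ≈-trans (≈-sym (rep-[] a)) (subst (λ p → rep p ≈ b) (sym [a]≡[b]) (rep-[] b))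

  []-rep : ∀ p → [ rep p ] ≡ p
  []-rep p = ≈⇒≡ [ rep p ] p (rep-[] (rep p))

  adjᵠ : QVertex G → QVertex G → Bool
  adjᵠ p q = adj G (rep p) (rep q)

  adjᵠ-[] : ∀ a b → adjᵠ [ a ] [ b ] ≡ adj G a b
  adjᵠ-[] a b = adj-resp-≈ (rep-[] a) (rep-[] b)

  _≟ᵠ_ : DecidableEquality (QVertex G)
  p ≟ᵠ q = map′ (λ e → ≈⇒≡ p q λ w → cong (λ a → adj G a w) e) (cong rep) (rep p ≟ᶠ rep q)

  QAdj⇔adjᵠ : ∀ p q → QAdj G p q ⇔ adjᵠ p q ≡ true
  QAdj⇔adjᵠ p q = mk⇔
    (λ (_ , a , b , a≈p , b≈q , a~b) → trans (sym (adj-resp-≈ a≈p b≈q)) a~b)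
    (λ p~q → (λ p≡q → Adjᶠ⇒≉ p~q (subst (rep p ≈_) p≡q ≈-refl))
           , rep p , rep q , ≈-refl , ≈-refl , p~q)

  Adjᶠ⇒QAdj : ∀ {a b} → Adjᶠ G a b → QAdj G [ a ] [ b ]
  Adjᶠ⇒QAdj {a} {b} a~b = Equivalence.from (QAdj⇔adjᵠ [ a ] [ b ]) (trans (adjᵠ-[] a b) a~b)

  Adjᶠ⇒[]≢ : ∀ {a b} → Adjᶠ G a b → [ a ] ≢ [ b ]
  Adjᶠ⇒[]≢ a~b [a]≡[b] = Adjᶠ⇒≉ a~b ([]-≡ [a]≡[b])

  open BooleanAdjacency (toGraph G) (adj G) (λ _ _ → ⇔.refl)
    renaming (χ-app to adj-app; χ-automorphism to automorphism)
  module Quotient = BooleanAdjacency (twinQuotient G) adjᵠ QAdj⇔adjᵠ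

  module _ (σ : Automorphism (toGraph G)) where
    open Inverse (perm σ) using (to; from; strictlyInverseˡ)

    ≈-app : ∀ {a b} → a ≈ b → app σ a ≈ app σ b
    ≈-app {a} {b} a≈b w = begin
      adj G (to a) w             ≡⟨ cong (adj G (to a)) (strictlyInverseˡ w) ⟨
      adj G (to a) (to (from w)) ≡⟨ adj-app σ a (from w) ⟩
      adj G a (from w)           ≡⟨ a≈b (from w) ⟩
      adj G b (from w)           ≡⟨ adj-app σ b (from w) ⟨
      adj G (to b) (to (from w)) ≡⟨ cong (adj G (to b)) (strictlyInverseˡ w) ⟩
      adj G (to b) w             ∎
      where open ≡-Reasoning

    []-app : ∀ {a b} → [ a ] ≡ [ b ] → [ app σ a ] ≡ [ app σ b ]
    []-app [a]≡[b] = []-≈ (≈-app ([]-≡ [a]≡[b]))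

    quotientMap : QVertex G → QVertex G
    quotientMap p = [ app σ (rep p) ]

    quotientMap-[] : ∀ w → quotientMap [ w ] ≡ [ app σ w ]
    quotientMap-[] w = []-app ([]-rep [ w ])

  quotientMap-invert : ∀ σ p → quotientMap σ (quotientMap (invert σ) p) ≡ p
  quotientMap-invert σ p = begin
    quotientMap σ [ from (rep p) ] ≡⟨ quotientMap-[] σ (from (rep p)) ⟩
    [ to (from (rep p)) ]          ≡⟨ cong [_] (strictlyInverseˡ (rep p)) ⟩
    [ rep p ]                      ≡⟨ []-rep p ⟩
    p                              ∎
    where
    open ≡-Reasoning
    open Inverse (perm σ) using (to; from; strictlyInverseˡ)

  quotientAutomorphism : Automorphism (toGraph G) → Automorphism (twinQuotient G)
  quotientAutomorphism σ = Quotient.χ-automorphism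
    (mk↔ₛ′ (quotientMap σ) (quotientMap (invert σ))
           (quotientMap-invert σ) (quotientMap-invert (invert σ)))
    (λ p q → trans (adjᵠ-[] _ _) (adj-app σ (rep p) (rep q)))

  arcTransitive⇒quotient : ArcTransitive (toGraph G) → ArcTransitive (twinQuotient G)
  arcTransitive⇒quotient arcT p q x y p~q x~y
    with σ , σp≡x , σq≡y ← arcT (rep p) (rep q) (rep x) (rep y)
                                (Equivalence.to (QAdj⇔adjᵠ p q) p~q)
                                (Equivalence.to (QAdj⇔adjᵠ x y) x~y)
    = quotientAutomorphism σ
    , trans (cong [_] σp≡x) ([]-rep x)
    , trans (cong [_] σq≡y) ([]-rep y)

  module Lift (τ : Automorphism (twinQuotient G))
              (g : QVertex G → Automorphism (toGraph G))
              (g-into : ∀ r → [ app (g r) (rep r) ] ≡ app τ r) where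
    open Inverse (perm τ) using () renaming
      (from to τ⁻¹; strictlyInverseˡ to τ-τ⁻¹; strictlyInverseʳ to τ⁻¹-τ)
    open ≡-Reasoning

    lift : Fin n → Fin n
    lift w = app (g [ w ]) w

    unlift : Fin n → Fin n
    unlift z = app (invert (g (τ⁻¹ [ z ]))) z

    [lift] : ∀ w → [ lift w ] ≡ app τ [ w ]
    [lift] w = trans ([]-app (g [ w ]) (sym ([]-rep [ w ]))) (g-into [ w ])

    [unlift] : ∀ z → [ unlift z ] ≡ τ⁻¹ [ z ]
    [unlift] z = begin
      [ from z ]               ≡⟨ []-app (invert (g r)) (sym (trans (g-into r) (τ-τ⁻¹ [ z ]))) ⟩
      [ from (to (rep r)) ]    ≡⟨ cong [_] (strictlyInverseʳ (rep r)) ⟩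
      [ rep r ]                ≡⟨ []-rep r ⟩
      r                        ∎
      where
      r = τ⁻¹ [ z ]
      open Inverse (perm (g r)) using (to; from; strictlyInverseʳ)

    lift-unlift : ∀ z → lift (unlift z) ≡ z
    lift-unlift z = begin
      app (g [ unlift z ]) (unlift z) ≡⟨ cong (λ r′ → app (g r′) (unlift z)) ([unlift] z) ⟩
      to (from z)                     ≡⟨ strictlyInverseˡ z ⟩
      z                               ∎
      where open Inverse (perm (g (τ⁻¹ [ z ]))) using (to; from; strictlyInverseˡ)

    unlift-lift : ∀ w → unlift (lift w) ≡ w
    unlift-lift w = begin
      app (invert (g (τ⁻¹ [ lift w ]))) (lift w) ≡⟨ cong (λ r → app (invert (g r)) (lift w)) τ⁻¹[lift] ⟩
      from (to w)                                ≡⟨ strictlyInverseʳ w ⟩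
      w                                          ∎
      where
      open Inverse (perm (g [ w ])) using (to; from; strictlyInverseʳ)
      τ⁻¹[lift] : τ⁻¹ [ lift w ] ≡ [ w ]
      τ⁻¹[lift] = trans (cong τ⁻¹ ([lift] w)) (τ⁻¹-τ [ w ])

    adj-lift : ∀ a b → adj G (lift a) (lift b) ≡ adj G a b
    adj-lift a b = begin
      adj G (lift a) (lift b)          ≡⟨ adjᵠ-[] (lift a) (lift b) ⟨
      adjᵠ [ lift a ] [ lift b ]       ≡⟨ cong₂ adjᵠ ([lift] a) ([lift] b) ⟩
      adjᵠ (app τ [ a ]) (app τ [ b ]) ≡⟨ Quotient.χ-app τ [ a ] [ b ] ⟩
      adjᵠ [ a ] [ b ]                 ≡⟨ adjᵠ-[] a b ⟩
      adj G a b                        ∎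

    liftAutomorphism : Automorphism (toGraph G)
    liftAutomorphism = automorphism (mk↔ₛ′ lift unlift lift-unlift unlift-lift) adj-lift

  module LiftArc (vertexT : VertexTransitive (toGraph G))
                 (τ : Automorphism (twinQuotient G))
                 {u v x y : Fin n} ([u]≢[v] : [ u ] ≢ [ v ])
                 (τ[u] : app τ [ u ] ≡ [ x ]) (τ[v] : app τ [ v ] ≡ [ y ]) where

    ends : QVertex G → Fin n × Fin n
    ends r with r ≟ᵠ [ u ] | r ≟ᵠ [ v ]
    ... | yes _ | _     = u , x
    ... | no _  | yes _ = v , y
    ... | no _  | no _  = rep r , rep (app τ r)

    ends-classes : ∀ r → [ proj₁ (ends r) ] ≡ r × [ proj₂ (ends r) ] ≡ app τ r
    ends-classes r with r ≟ᵠ [ u ] | r ≟ᵠ [ v ]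
    ... | yes refl | _        = refl , sym τ[u]
    ... | no _     | yes refl = refl , sym τ[v]
    ... | no _     | no _     = []-rep r , []-rep (app τ r)

    ends-[u] : ends [ u ] ≡ (u , x)
    ends-[u] with [ u ] ≟ᵠ [ u ]
    ... | yes _   = refl
    ... | no [u]≢ = contradiction refl [u]≢

    ends-[v] : ends [ v ] ≡ (v , y)
    ends-[v] with [ v ] ≟ᵠ [ u ] | [ v ] ≟ᵠ [ v ]
    ... | yes [v]≡[u] | _       = contradiction (sym [v]≡[u]) [u]≢[v]
    ... | no _        | yes _   = refl
    ... | no _        | no [v]≢ = contradiction refl [v]≢

    g : QVertex G → Automorphism (toGraph G)
    g r = proj₁ (vertexT (proj₁ (ends r)) (proj₂ (ends r)))

    g-ends : ∀ r → app (g r) (proj₁ (ends r)) ≡ proj₂ (ends r)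
    g-ends r = proj₂ (vertexT (proj₁ (ends r)) (proj₂ (ends r)))

    g-into : ∀ r → [ app (g r) (rep r) ] ≡ app τ r
    g-into r = begin
      [ app (g r) (rep r) ]             ≡⟨ []-app (g r) (trans ([]-rep r) (sym (proj₁ (ends-classes r)))) ⟩
      [ app (g r) (proj₁ (ends r)) ]    ≡⟨ cong [_] (g-ends r) ⟩
      [ proj₂ (ends r) ]                ≡⟨ proj₂ (ends-classes r) ⟩
      app τ r                           ∎
      where open ≡-Reasoning

    open Lift τ g g-into public

    lift-ends : ∀ {w z} → ends [ w ] ≡ (w , z) → lift w ≡ z
    lift-ends {w} ends≡ = subst (λ e → app (g [ w ]) (proj₁ e) ≡ proj₂ e) ends≡ (g-ends [ w ])

  quotient⇒arcTransitive : VertexTransitive (toGraph G) →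
                           ArcTransitive (twinQuotient G) → ArcTransitive (toGraph G)
  quotient⇒arcTransitive vertexT arcQ u v x y u~v x~y
    with τ , τ[u] , τ[v] ← arcQ [ u ] [ v ] [ x ] [ y ] (Adjᶠ⇒QAdj u~v) (Adjᶠ⇒QAdj x~y)
    = liftAutomorphism , lift-ends ends-[u] , lift-ends ends-[v]
    where open LiftArc vertexT τ (Adjᶠ⇒[]≢ u~v) τ[u] τ[v]

corollary12 : (n : ℕ) (G : FinGraph n) →
    VertexTransitive (toGraph G) →
    (∀ u → HasNonadjTwin G u) →
    ArcTransitive (toGraph G) ⇔ ArcTransitive (twinQuotient G)
corollary12 n G vertexT _ = mk⇔ arcTransitive⇒quotient (quotient⇒arcTransitive vertexT)
  where open TwinClasses G
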